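{- Let $(X,A,f,\alpha,r)$ be an entropy preserving reversible micro-macro dynamical system, $n\ge1$ an integer, and $x\in\mathbb{R}_{\ge0}$. Then (1) $W_n^u(x)=W_n^u(-x)$; (2) $W^u_{n,\mathrm{neq}}(x)\ge W^u_{n,\mathrm{neq}}(-x)$; (3) $W_n^q(x)=e^{nx}\,W_n^q(-x)$.
   Context: A reversible micro-macro dynamical system is $(X,A,f,\alpha,r)$ with $X,A$ finite, $f:X\to A$ surjective, $\alpha$ a bijection of $X$, $r$ an involution of $X$ with $r\alpha r=\alpha^{ -1}$. For $i\in X$, $|i|=|f^{ -1}(f(i))|$, $S(i)=\ln|i|$; entropy preserving means $S(r(i))=S(i)$ for all $i$. $X^{\mathrm{eq}}$ is the set of microstates in macrostates of maximal cardinality, $X^{\mathrm{neq}}=X\setminus X^{\mathrm{eq}}$ (assumed nonempty so that $W^u_{n,\mathrm{neq}}$ is defined). The $n$-step entropy production rate is $\sigma_n(i)=\frac{S(\alpha^n(i))-S(i)}{n}$. Define $W_n^u(x)=\frac{|\{i\in X:\sigma_n(i)=x\}|}{|X|}$, $W^u_{n,\mathrm{neq}}(x)=\frac{|\{i\in X^{\mathrm{neq}}:\sigma_n(i)=x\}|}{|X^{\mathrm{neq}}|}$, and $W_n^q(x)=\sum_{i:\sigma_n(i)=x}\frac{1}{|A|\,|i|}$. -}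

module Defs where

open import Data.Nat as ℕ using (ℕ; zero; suc; _*_; _<_)
open import Data.Nat.Properties using (_<?_)
open import Data.Fin using (Fin)
open import Data.Fin.Properties using (_≟_)
open import Data.Fin.Permutation using (Permutation′; _⟨$⟩ʳ_)
open import Data.List using (List; length; filter; foldr; map)
open import Data.Bool.ListAction using () renaming (any to anyᵇ)
open import Data.Fin.Base using () renaming (toℕ to toℕ)
open import Data.Bool using (Bool; true; false; T)
open import Data.Integer using (+_)
open import Data.Rational as ℚ using (ℚ; 0ℚ; _/_)
open import Data.Product using (∃)
open import Relation.Binary.PropositionalEquality using (_≡_)
open import Relation.Nullary.Decidable using (⌊_⌋)
open import Data.List using () renaming (allFin to allFinL)

univ : (N : ℕ) → List (Fin N)
univ N = allFinL N

card : {N M : ℕ} → (Fin N → Fin M) → Fin N → ℕ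
card {N} f i = length (filter (λ j → f j ≟ f i) (univ N))

iter : {N : ℕ} → Permutation′ N → ℕ → Fin N → Fin N
iter α zero i = i
iter α (suc n) i = α ⟨$⟩ʳ iter α n i

-- entropy preserving: S(r i) = S(i), i.e. ln|r i| = ln|i|, i.e. |r i| = |i|
EntropyPreserving : {N M : ℕ} → (Fin N → Fin M) → (Fin N → Fin N) → Set
EntropyPreserving f r = ∀ i → card f (r i) ≡ card f i

isNeq : {N M : ℕ} → (Fin N → Fin M) → Fin N → Bool
isNeq {N} f i = anyᵇ (λ j → ⌊ card f i <? card f j ⌋) (univ N)

-- 1/k as a rational (k = 0 ↦ 0; only used for k ≥ 1)
inv : ℕ → ℚ
inv zero = 0ℚ
inv (suc k) = (+ 1) / suc k

sumℚ : List ℚ → ℚ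
sumℚ = foldr ℚ._+_ 0ℚ

-- σ_n(i) = x with e^{n x} = p / d  (d ≥ 1) :  ln|α^n i| - ln|i| = ln(p/d),
-- i.e. |α^n i| * d = |i| * p.
RatioIs : {N M : ℕ} → (Fin N → Fin M) → Permutation′ N → ℕ → ℕ → ℕ → Fin N → Bool
RatioIs f α n p d i = ⌊ card f (iter α n i) * d ℕ.≟ card f i * p ⌋

Wu : {N M : ℕ} → (Fin N → Fin M) → Permutation′ N → ℕ → ℕ → ℕ → ℚ
Wu {N} f α n p d = ((+ length (filter (λ i → T? (RatioIs f α n p d i)) (univ N))) / 1) ℚ.* inv N
  where
  open import Relation.Nullary.Decidable using () renaming (T? to T?)

WuNeq : {N M : ℕ} → (Fin N → Fin M) → Permutation′ N → ℕ → ℕ → ℕ → ℚ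
WuNeq {N} f α n p d =
  ((+ length (filter (λ i → T? (isNeq f i Data.Bool.∧ RatioIs f α n p d i)) (univ N))) / 1)
    ℚ.* inv (length (filter (λ i → T? (isNeq f i)) (univ N)))
  where
  open import Relation.Nullary.Decidable using () renaming (T? to T?)

Wq : {N M : ℕ} → (Fin N → Fin M) → Permutation′ N → ℕ → ℕ → ℕ → ℚ
Wq {N} {M} f α n p d =
  sumℚ (map (λ i → inv (M * card f i))
            (filter (λ i → T? (RatioIs f α n p d i)) (univ N)))
  where
  open import Relation.Nullary.Decidable using () renaming (T? to T?)

{-# OPTIONS --safe #-}
-- Reversibility gives αⁿ ∘ r ∘ αⁿ = r, so i ↦ r (αⁿ i) is an involution of X, and by entropy
-- preservation it swaps |i| and |αⁿ i|; hence it maps {σₙ = x} bijectively onto {σₙ = -x}.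
-- Reindexing along it gives (1), and (3) since the weight 1/(|A| |i|) changes by the factor
-- |i| / |αⁿ i| = e^{nx}. For (2): if σₙ(i) = x ≥ 0, the macrostate of r (αⁿ i) is at least as
-- large as that of i, so r (αⁿ i) ∈ X^neq forces i ∈ X^neq.
module Submission where

open import Defs
open import Data.Nat using (ℕ; _≤_; NonZero)
open import Data.Fin using (Fin)
open import Data.Fin.Permutation using (Permutation′; _⟨$⟩ʳ_; _⟨$⟩ˡ_)
open import Data.Bool using (T)
open import Data.Integer using (+_)
open import Data.Rational using (_/_; _*_) renaming (_≤_ to _≤ℚ_)
open import Data.Product using (∃; _×_)
open import Relation.Binary.PropositionalEquality using (_≡_)

open import Algebra.Bundles using (Monoid; Ring)
import Algebra.Properties.CommutativeMonoid.Sum as CommutativeMonoidSum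
import Algebra.Properties.Monoid.Sum as MonoidSum
import Algebra.Properties.Semiring.Sum as SemiringSum
open import Data.Bool using (Bool; true; false; if_then_else_; _∧_)
open import Data.Bool.Properties using (T-∧)
open import Data.Empty using (⊥-elim)
open import Data.Fin using (zero; suc)
import Data.Fin.Permutation as Perm
import Data.Integer as ℤ
import Data.Integer.Properties as ℤ
open import Data.List using (List; []; _∷_; length; filter; foldr; map; tabulate; allFin)
open import Data.List.Relation.Unary.Any as Any using ()
open import Data.List.Relation.Unary.Any.Properties using (any⁺; any⁻)
open import Data.Nat as ℕ using (zero; suc; z≤n)
import Data.Nat.Properties as ℕ
open import Data.Product using (_,_; proj₁; proj₂)
open import Data.Rational as ℚ using (ℚ; 0ℚ; NonNegative)
import Data.Rational.Properties as ℚ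
open import Data.Rational.Unnormalised using (mkℚᵘ; *≡*; *≤*) renaming (_*_ to _*ᵘ_)
import Data.Rational.Unnormalised.Properties as ℚᵘ
open import Function using (_∘_; const; Equivalence; mk⇔)
open import Relation.Binary.PropositionalEquality using (refl; sym; trans; cong; cong₂; subst; module ≡-Reasoning)
open import Relation.Nullary.Decidable using (⌊_⌋; does; T?; toWitness; fromWitness; does-⇔; isYes≗does)

module _ {c ℓ} (M : Monoid c ℓ) where
  open Monoid M using (Carrier; _≈_; _∙_; ε; ∙-congˡ; identityˡ)
    renaming (refl to ≈-refl; sym to ≈-sym; trans to ≈-trans)
  open MonoidSum M using (sum)

  foldr-filter≈∑ : ∀ {n a} {A : Set a} (h : Fin n → A) (b : A → Bool) (w : A → Carrier) →
    foldr _∙_ ε (map w (filter (T? ∘ b) (tabulate h)))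
      ≈ sum (λ i → if b (h i) then w (h i) else ε)
  foldr-filter≈∑ {zero} h b w = ≈-refl
  foldr-filter≈∑ {suc n} h b w with b (h zero)
  ... | true  = ∙-congˡ (foldr-filter≈∑ (h ∘ suc) b w)
  ... | false = ≈-trans (foldr-filter≈∑ (h ∘ suc) b w) (≈-sym (identityˡ _))

module ℕ∑ = CommutativeMonoidSum ℕ.+-0-commutativeMonoid
module ℚ∑ = SemiringSum (Ring.semiring ℚ.+-*-ring)

length≡foldr-map-const-1 : ∀ {a} {A : Set a} (xs : List A) →
  length xs ≡ foldr ℕ._+_ 0 (map (const 1) xs)
length≡foldr-map-const-1 []       = refl
length≡foldr-map-const-1 (x ∷ xs) = cong suc (length≡foldr-map-const-1 xs)

indicator : Bool → ℕ
indicator b = if b then 1 else 0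

indicator-mono : ∀ {x y} → (T x → T y) → indicator x ≤ indicator y
indicator-mono {false}         _   = z≤n
indicator-mono {true}  {true}  _   = ℕ.≤-refl
indicator-mono {true}  {false} x⇒y = ⊥-elim (x⇒y _)

∑-mono-≤ : ∀ {n} {u v : Fin n → ℕ} → (∀ i → u i ≤ v i) → ℕ∑.sum u ≤ ℕ∑.sum v
∑-mono-≤ {zero}  u≤v = z≤n
∑-mono-≤ {suc n} u≤v = ℕ.+-mono-≤ (u≤v zero) (∑-mono-≤ (u≤v ∘ suc))

if-then-0-scale : ∀ {x : Bool} {u v : ℚ} (k : ℚ) → (T x → u ≡ k * v) →
  (if x then u else 0ℚ) ≡ k * (if x then v else 0ℚ)
if-then-0-scale {true}  k u≡kv = u≡kv _
if-then-0-scale {false} k _    = sym (ℚ.*-zeroʳ k)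

module _ {N : ℕ} where

  count : (Fin N → Bool) → ℕ
  count b = length (filter (T? ∘ b) (allFin N))

  count≡∑ : (b : Fin N → Bool) → count b ≡ ℕ∑.sum (indicator ∘ b)
  count≡∑ b = trans (length≡foldr-map-const-1 (filter (T? ∘ b) (allFin N)))
    (foldr-filter≈∑ ℕ.+-0-monoid (λ i → i) b (const 1))

  count-reindex : (π : Permutation′ N) {b c : Fin N → Bool} →
    (∀ i → b (π ⟨$⟩ʳ i) ≡ c i) → count b ≡ count c
  count-reindex π {b} {c} bπ≗c = begin
    count b                            ≡⟨ count≡∑ b ⟩
    ℕ∑.sum (indicator ∘ b)             ≡⟨ ℕ∑.sum-permute (indicator ∘ b) π ⟩
    ℕ∑.sum (indicator ∘ b ∘ (π ⟨$⟩ʳ_)) ≡⟨ ℕ∑.sum-cong-≗ (cong indicator ∘ bπ≗c) ⟩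
    ℕ∑.sum (indicator ∘ c)             ≡⟨ count≡∑ c ⟨
    count c                            ∎
    where open ≡-Reasoning

  count-reindex-≤ : (π : Permutation′ N) {b c : Fin N → Bool} →
    (∀ i → T (c (π ⟨$⟩ʳ i)) → T (b i)) → count c ≤ count b
  count-reindex-≤ π {b} {c} cπ⇒b = begin
    count c                            ≡⟨ count≡∑ c ⟩
    ℕ∑.sum (indicator ∘ c)             ≡⟨ ℕ∑.sum-permute (indicator ∘ c) π ⟩
    ℕ∑.sum (indicator ∘ c ∘ (π ⟨$⟩ʳ_)) ≤⟨ ∑-mono-≤ (indicator-mono ∘ cπ⇒b) ⟩
    ℕ∑.sum (indicator ∘ b)             ≡⟨ count≡∑ b ⟨
    count b                            ∎
    where open ℕ.≤-Reasoning

  filteredSum : (Fin N → ℚ) → (Fin N → Bool) → ℚ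
  filteredSum w b = sumℚ (map w (filter (T? ∘ b) (allFin N)))

  masked : (Fin N → Bool) → (Fin N → ℚ) → Fin N → ℚ
  masked b w i = if b i then w i else 0ℚ

  filteredSum≡∑ : (w : Fin N → ℚ) (b : Fin N → Bool) → filteredSum w b ≡ ℚ∑.sum (masked b w)
  filteredSum≡∑ w b = foldr-filter≈∑ ℚ.+-0-monoid (λ i → i) b w

  filteredSum-reindex : (π : Permutation′ N) (k : ℚ) {w : Fin N → ℚ} {b c : Fin N → Bool} →
    (∀ i → b (π ⟨$⟩ʳ i) ≡ c i) → (∀ i → T (c i) → w (π ⟨$⟩ʳ i) ≡ k * w i) →
    filteredSum w b ≡ k * filteredSum w c
  filteredSum-reindex π k {w} {b} {c} bπ≗c wπ≡kw = begin
    filteredSum w b                         ≡⟨ filteredSum≡∑ w b ⟩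
    ℚ∑.sum (masked b w)                     ≡⟨ ℚ∑.sum-permute (masked b w) π ⟩
    ℚ∑.sum (masked b w ∘ (π ⟨$⟩ʳ_))         ≡⟨ ℚ∑.sum-cong-≗ scaled ⟩
    ℚ∑.sum (λ i → k * masked c w i)         ≡⟨ ℚ∑.*-distribˡ-sum k (masked c w) ⟨
    k * ℚ∑.sum (masked c w)                 ≡⟨ cong (k *_) (filteredSum≡∑ w c) ⟨
    k * filteredSum w c                     ∎
    where
    open ≡-Reasoning
    scaled : ∀ i → masked b w (π ⟨$⟩ʳ i) ≡ k * masked c w i
    scaled i = trans (cong (λ x → if x then w (π ⟨$⟩ʳ i) else 0ℚ) (bπ≗c i)) (if-then-0-scale k (wπ≡kw i))

/1-mono-≤ : ∀ {a b} → a ℕ.≤ b → (+ a) / 1 ≤ℚ (+ b) / 1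
/1-mono-≤ {a} {b} a≤b = ℚ.toℚᵘ-cancel-≤ (begin
  ℚ.toℚᵘ ((+ a) / 1)  ≃⟨ ℚ.toℚᵘ-fromℚᵘ (mkℚᵘ (+ a) 0) ⟩
  mkℚᵘ (+ a) 0        ≤⟨ *≤* (ℤ.*-monoʳ-≤-nonNeg (+ 1) (ℤ.+≤+ a≤b)) ⟩
  mkℚᵘ (+ b) 0        ≃⟨ ℚ.toℚᵘ-fromℚᵘ (mkℚᵘ (+ b) 0) ⟨
  ℚ.toℚᵘ ((+ b) / 1)  ∎)
  where open ℚᵘ.≤-Reasoning

inv-nonNegative : ∀ k → NonNegative (inv k)
inv-nonNegative zero    = _
inv-nonNegative (suc k) = ℚ.normalize-nonNeg 1 (suc k)

inv-rescale : ∀ x y p d .{{_ : NonZero p}} .{{_ : NonZero d}} →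
  y ℕ.* p ≡ x ℕ.* d → inv y ≡ ((+ p) / d) * inv x
inv-rescale zero y p d yp≡0 rewrite ℕ.m*n≡0⇒m≡0 y p yp≡0 = sym (ℚ.*-zeroʳ ((+ p) / d))
inv-rescale (suc x) (suc y) (suc p) (suc d) yp≡xd = ℚ.toℚᵘ-injective (begin
  ℚ.toℚᵘ (inv (suc y))
    ≈⟨ ℚ.toℚᵘ-fromℚᵘ (mkℚᵘ (+ 1) y) ⟩
  mkℚᵘ (+ 1) y
    ≈⟨ *≡* (cong +_ dx≡py) ⟩
  mkℚᵘ (+ suc p) d *ᵘ mkℚᵘ (+ 1) x
    ≈⟨ ℚᵘ.*-cong (ℚ.toℚᵘ-fromℚᵘ (mkℚᵘ (+ suc p) d)) (ℚ.toℚᵘ-fromℚᵘ (mkℚᵘ (+ 1) x)) ⟨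
  ℚ.toℚᵘ ((+ suc p) / suc d) *ᵘ ℚ.toℚᵘ (inv (suc x))
    ≈⟨ ℚ.toℚᵘ-homo-* ((+ suc p) / suc d) (inv (suc x)) ⟨
  ℚ.toℚᵘ (((+ suc p) / suc d) * inv (suc x))
    ∎)
  where
  open ℚᵘ.≃-Reasoning
  dx≡py : 1 ℕ.* (suc d ℕ.* suc x) ≡ (suc p ℕ.* 1) ℕ.* suc y
  dx≡py = trans (ℕ.*-identityˡ _) (trans (ℕ.*-comm (suc d) (suc x)) (trans (sym yp≡xd)
            (trans (ℕ.*-comm (suc y) (suc p)) (cong (ℕ._* suc y) (sym (ℕ.*-identityʳ (suc p)))))))

⌊≟⌋-sym : ∀ a b → ⌊ a ℕ.≟ b ⌋ ≡ ⌊ b ℕ.≟ a ⌋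
⌊≟⌋-sym a b = begin
  ⌊ a ℕ.≟ b ⌋    ≡⟨ isYes≗does (a ℕ.≟ b) ⟩
  does (a ℕ.≟ b) ≡⟨ does-⇔ (mk⇔ sym sym) (a ℕ.≟ b) (b ℕ.≟ a) ⟩
  does (b ℕ.≟ a) ≡⟨ isYes≗does (b ℕ.≟ a) ⟨
  ⌊ b ℕ.≟ a ⌋    ∎
  where open ≡-Reasoning

iter-suc : ∀ {N} (α : Permutation′ N) n i → iter α (suc n) i ≡ iter α n (α ⟨$⟩ʳ i)
iter-suc α zero    i = refl
iter-suc α (suc n) i = cong (α ⟨$⟩ʳ_) (iter-suc α n i)

isNeq-antitone : ∀ {N M} (f : Fin N → Fin M) {i j} → card f i ≤ card f j → T (isNeq f j) → T (isNeq f i)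
isNeq-antitone {N} f i≤j =
  any⁺ _ ∘ Any.map (λ j<k → fromWitness (ℕ.≤-<-trans i≤j (toWitness j<k))) ∘ any⁻ _ (univ N)

module _ {N M : ℕ} (f : Fin N → Fin M) (α : Permutation′ N) (n : ℕ) where

  RatioIs-sound : ∀ {p d i} → T (RatioIs f α n p d i) → card f (iter α n i) ℕ.* d ≡ card f i ℕ.* p
  RatioIs-sound {p} {d} {i} = toWitness {a? = card f (iter α n i) ℕ.* d ℕ.≟ card f i ℕ.* p}

  RatioIs⇒card≤ : ∀ {p d} .{{_ : NonZero d}} → d ≤ p → ∀ {i} →
    T (RatioIs f α n p d i) → card f i ≤ card f (iter α n i)
  RatioIs⇒card≤ {p} {d} d≤p {i} ratio = ℕ.*-cancelʳ-≤ (card f i) (card f (iter α n i)) d (begin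
    card f i ℕ.* d              ≤⟨ ℕ.*-monoʳ-≤ (card f i) d≤p ⟩
    card f i ℕ.* p              ≡⟨ RatioIs-sound ratio ⟨
    card f (iter α n i) ℕ.* d   ∎)
    where open ℕ.≤-Reasoning

module Reversible {N : ℕ} (α : Permutation′ N) (r : Fin N → Fin N)
    (r-involutive : ∀ i → r (r i) ≡ i)
    (r-reverses-α : ∀ i → r (α ⟨$⟩ʳ r i) ≡ α ⟨$⟩ˡ i) where

  α-r-α : ∀ i → α ⟨$⟩ʳ r (α ⟨$⟩ʳ i) ≡ r i
  α-r-α i = begin
    α ⟨$⟩ʳ r (α ⟨$⟩ʳ i)         ≡⟨ cong (λ j → α ⟨$⟩ʳ r (α ⟨$⟩ʳ j)) (r-involutive i) ⟨
    α ⟨$⟩ʳ r (α ⟨$⟩ʳ r (r i))   ≡⟨ cong (α ⟨$⟩ʳ_) (r-reverses-α (r i)) ⟩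
    α ⟨$⟩ʳ (α ⟨$⟩ˡ r i)         ≡⟨ Perm.inverseʳ α ⟩
    r i                         ∎
    where open ≡-Reasoning

  iter-r-iter : ∀ n i → iter α n (r (iter α n i)) ≡ r i
  iter-r-iter zero    i = refl
  iter-r-iter (suc n) i = begin
    α ⟨$⟩ʳ iter α n (r (iter α (suc n) i))    ≡⟨ cong (λ j → α ⟨$⟩ʳ iter α n (r j)) (iter-suc α n i) ⟩
    α ⟨$⟩ʳ iter α n (r (iter α n (α ⟨$⟩ʳ i))) ≡⟨ cong (α ⟨$⟩ʳ_) (iter-r-iter n (α ⟨$⟩ʳ i)) ⟩
    α ⟨$⟩ʳ r (α ⟨$⟩ʳ i)                       ≡⟨ α-r-α i ⟩
    r i                                       ∎
    where open ≡-Reasoning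

  rαⁿ : ℕ → Fin N → Fin N
  rαⁿ n i = r (iter α n i)

  rαⁿ-involutive : ∀ n i → rαⁿ n (rαⁿ n i) ≡ i
  rαⁿ-involutive n i = trans (cong r (iter-r-iter n i)) (r-involutive i)

  rαⁿ-permutation : ℕ → Permutation′ N
  rαⁿ-permutation n = Perm.permutation (rαⁿ n) (rαⁿ n) (rαⁿ-involutive n) (rαⁿ-involutive n)

module EntropyPreservingReversible {N M : ℕ} (f : Fin N → Fin M) (α : Permutation′ N) (r : Fin N → Fin N)
    (r-involutive : ∀ i → r (r i) ≡ i)
    (r-reverses-α : ∀ i → r (α ⟨$⟩ʳ r i) ≡ α ⟨$⟩ˡ i)
    (entropyPreserving : EntropyPreserving f r) (n : ℕ) where

  open Reversible α r r-involutive r-reverses-α public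

  card-rαⁿ : ∀ i → card f (rαⁿ n i) ≡ card f (iter α n i)
  card-rαⁿ i = entropyPreserving (iter α n i)

  card-iter-rαⁿ : ∀ i → card f (iter α n (rαⁿ n i)) ≡ card f i
  card-iter-rαⁿ i = trans (cong (card f) (iter-r-iter n i)) (entropyPreserving i)

  RatioIs-rαⁿ : ∀ p d i → RatioIs f α n p d (rαⁿ n i) ≡ RatioIs f α n d p i
  RatioIs-rαⁿ p d i = begin
    ⌊ card f (iter α n (rαⁿ n i)) ℕ.* d ℕ.≟ card f (rαⁿ n i) ℕ.* p ⌋
      ≡⟨ cong₂ (λ a b → ⌊ a ℕ.* d ℕ.≟ b ℕ.* p ⌋) (card-iter-rαⁿ i) (card-rαⁿ i) ⟩
    ⌊ card f i ℕ.* d ℕ.≟ card f (iter α n i) ℕ.* p ⌋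
      ≡⟨ ⌊≟⌋-sym (card f i ℕ.* d) (card f (iter α n i) ℕ.* p) ⟩
    ⌊ card f (iter α n i) ℕ.* p ℕ.≟ card f i ℕ.* d ⌋
      ∎
    where open ≡-Reasoning

  isNeq-RatioIs-rαⁿ : ∀ {p d} .{{_ : NonZero d}} → d ≤ p → ∀ i →
    T (isNeq f (rαⁿ n i) ∧ RatioIs f α n d p (rαⁿ n i)) → T (isNeq f i ∧ RatioIs f α n p d i)
  isNeq-RatioIs-rαⁿ {p} {d} d≤p i neq∧ratio = Equivalence.from T-∧ (neq , ratio)
    where
    ratio : T (RatioIs f α n p d i)
    ratio = subst T (RatioIs-rαⁿ d p i) (proj₂ (Equivalence.to T-∧ neq∧ratio))
    neq : T (isNeq f i)
    neq = isNeq-antitone f (subst (card f i ≤_) (sym (card-rαⁿ i)) (RatioIs⇒card≤ f α n d≤p ratio))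
            (proj₁ (Equivalence.to T-∧ neq∧ratio))

  weight-rαⁿ : ∀ p d .{{_ : NonZero p}} .{{_ : NonZero d}} i → T (RatioIs f α n d p i) →
    inv (M ℕ.* card f (rαⁿ n i)) ≡ ((+ p) / d) * inv (M ℕ.* card f i)
  weight-rαⁿ p d i ratio = inv-rescale (M ℕ.* card f i) (M ℕ.* card f (rαⁿ n i)) p d (begin
    M ℕ.* card f (rαⁿ n i) ℕ.* p         ≡⟨ ℕ.*-assoc M (card f (rαⁿ n i)) p ⟩
    M ℕ.* (card f (rαⁿ n i) ℕ.* p)       ≡⟨ cong (λ c → M ℕ.* (c ℕ.* p)) (card-rαⁿ i) ⟩
    M ℕ.* (card f (iter α n i) ℕ.* p)    ≡⟨ cong (M ℕ.*_) (RatioIs-sound f α n ratio) ⟩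
    M ℕ.* (card f i ℕ.* d)               ≡⟨ ℕ.*-assoc M (card f i) d ⟨
    M ℕ.* card f i ℕ.* d                 ∎)
    where open ≡-Reasoning

mainTheorem7 : (N M : ℕ) (f : Fin N → Fin M) (α : Permutation′ N) (r : Fin N → Fin N)
    → (∀ a → ∃ λ i → f i ≡ a)
    → (∀ i → r (r i) ≡ i)
    → (∀ i → r (α ⟨$⟩ʳ (r i)) ≡ α ⟨$⟩ˡ i)
    → EntropyPreserving f r
    → (∃ λ i → T (isNeq f i))
    → (n : ℕ) → 1 ≤ n
    → (p d : ℕ) → .{{_ : NonZero d}} → d ≤ p
    → (Wu f α n p d ≡ Wu f α n d p)
    × (WuNeq f α n d p ≤ℚ WuNeq f α n p d)
    × (Wq f α n p d ≡ ((+ p) / d) * Wq f α n d p)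
-- Surjectivity of f, X^neq ≠ ∅ and 1 ≤ n only make the W's meaningful; the identities hold without them.
mainTheorem7 N _ f α r _ r-involutive r-reverses-α entropyPreserving _ n _ p d d≤p =
  cong (λ k → ((+ k) / 1) * inv N) (count-reindex π (RatioIs-rαⁿ p d)) ,
  ℚ.*-monoʳ-≤-nonNeg (inv (count (isNeq f))) {{inv-nonNegative (count (isNeq f))}}
    (/1-mono-≤ (count-reindex-≤ π (isNeq-RatioIs-rαⁿ d≤p))) ,
  filteredSum-reindex π ((+ p) / d) (RatioIs-rαⁿ p d) (weight-rαⁿ p d)
  where
  open EntropyPreservingReversible f α r r-involutive r-reverses-α entropyPreserving n
  π : Permutation′ N
  π = rαⁿ-permutation n
  instance
    p≢0 : NonZero p
    p≢0 = ℕ.>-nonZero (ℕ.<-≤-trans (ℕ.>-nonZero⁻¹ d) d≤p)
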